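{- Let $S$ be a strand and let $A$ be its bi-adjacency matrix, with rows indexed by the bottom vertices of $S$ listed from left to right and columns indexed by the top vertices of $S$ listed from left to right. Then for every square submatrix $B$ of $A$, $\operatorname{per}B=\det B$.
   Context: A strand is a weighted bipartite graph which is a path with pendant edges attached, drawn in the plane without edge crossings so that its bottom vertices $u_1,\dots,u_k$ lie from left to right on a horizontal line and its top vertices $v_1,\dots,v_l$ lie from left to right on a parallel horizontal line above it, every edge being a straight segment joining a bottom vertex to a top vertex; edge weights are arbitrary. Its bi-adjacency matrix is the $k\times l$ matrix whose $(p,q)$ entry is the weight of edge $\{u_p,v_q\}$ if present, and $0$ otherwise. The permanent of an $n\times n$ matrix $(b_{ij})$ is $\operatorname{per}B=\sum_{\pi\in S_n}\prod_{i=1}^n b_{i,\pi(i)}$. -}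

module Defs where

open import Level using (Level)
open import Algebra.Bundles using (CommutativeRing)
open import Data.Bool using (Bool; true; false; if_then_else_)
open import Data.Nat using (ℕ; zero; suc) renaming (_+_ to _+ℕ_)
open import Data.Fin using (Fin; zero; suc; _<_; _>_; _<?_)
open import Data.Fin.Properties using (all?; _≟_)
open import Data.Sum using (_⊎_; inj₁; inj₂)
open import Data.Product using (_×_; ∃)
open import Data.Empty using (⊥)
open import Data.List using (List; []; _∷_; map; concatMap; filter; foldr)
open import Data.List.Membership.Propositional using (_∈_; _∉_)
open import Data.List.Relation.Unary.Unique.Propositional using (Unique)
open import Data.List.Relation.Unary.Linked using (Linked)
open import Relation.Binary.PropositionalEquality using (_≡_)
open import Relation.Nullary using (¬_; Dec; yes; no)
open import Relation.Nullary.Decidable using (_→-dec_)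
open import Relation.Unary using (Decidable)

count : ∀ {n} → (Fin n → Bool) → ℕ
count {zero}  b = 0
count {suc n} b = (if b zero then 1 else 0) +ℕ count (λ i → b (suc i))

sumFin : ∀ {n} → (Fin n → ℕ) → ℕ
sumFin {zero}  f = 0
sumFin {suc n} f = f zero +ℕ sumFin (λ i → f (suc i))

-- Bipartite graphs between bottom vertices Fin k (u_1..u_k, left to
-- right) and top vertices Fin l (v_1..v_l, left to right).
-- E p q ≡ true  iff  {u_p , v_q} is an edge.

Vertex : ℕ → ℕ → Set
Vertex k l = Fin k ⊎ Fin l

Adj : ∀ {k l} → (Fin k → Fin l → Bool) → Vertex k l → Vertex k l → Set
Adj E (inj₁ p) (inj₂ q) = E p q ≡ true
Adj E (inj₂ q) (inj₁ p) = E p q ≡ true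
Adj E (inj₁ _) (inj₁ _) = ⊥
Adj E (inj₂ _) (inj₂ _) = ⊥

degree : ∀ {k l} → (Fin k → Fin l → Bool) → Vertex k l → ℕ
degree E (inj₁ p) = count (λ q → E p q)
degree E (inj₂ q) = count (λ p → E p q)

data Consecutive {A : Set} (x y : A) : List A → Set where
  here  : ∀ {zs} → Consecutive x y (x ∷ y ∷ zs)
  there : ∀ {z zs} → Consecutive x y zs → Consecutive x y (z ∷ zs)

PathEdge : ∀ {k l} → List (Vertex k l) → Vertex k l → Vertex k l → Set
PathEdge P a b = Consecutive a b P ⊎ Consecutive b a P

-- The graph is a path P (a list of distinct vertices, consecutive ones
-- adjacent) with pendant edges attached: every edge is an edge of the
-- path or joins a path vertex to a vertex outside the path of degree 1,
-- and every vertex outside the path has degree 1 (is the leaf of a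
-- pendant edge).
IsPathWithPendants : ∀ {k l} → (Fin k → Fin l → Bool) → List (Vertex k l) → Set
IsPathWithPendants {k} {l} E P =
  Unique P × Linked (Adj E) P ×
  (∀ (p : Fin k) (q : Fin l) → E p q ≡ true →
       PathEdge P (inj₁ p) (inj₂ q)
     ⊎ (inj₁ p ∈ P × inj₂ q ∉ P × degree E (inj₂ q) ≡ 1)
     ⊎ (inj₂ q ∈ P × inj₁ p ∉ P × degree E (inj₁ p) ≡ 1)) ×
  (∀ (v : Vertex k l) → v ∉ P → degree E v ≡ 1)

IsCaterpillar : ∀ {k l} → (Fin k → Fin l → Bool) → Set
IsCaterpillar {k} {l} E = ∃ λ (P : List (Vertex k l)) → IsPathWithPendants E P

-- Straight-line drawing with u_1..u_k left to right on the lower line and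
-- v_1..v_l left to right on the upper line has no edge crossings:
-- segments u_p v_q and u_p' v_q' cross exactly when p < p' and q > q'.
NonCrossing : ∀ {k l} → (Fin k → Fin l → Bool) → Set
NonCrossing {k} {l} E =
  ∀ (p p' : Fin k) (q q' : Fin l) → p < p' → q > q' →
    ¬ (E p q ≡ true × E p' q' ≡ true)

IsStrand : ∀ {k l} → (Fin k → Fin l → Bool) → Set
IsStrand E = IsCaterpillar E × NonCrossing E

allFuns : ∀ n m → List (Fin n → Fin m)
allFuns zero    m = (λ ()) ∷ []
allFuns (suc n) m =
  concatMap (λ f → map (λ j → λ { zero → j ; (suc i) → f i }) (allFinList m))
            (allFuns n m)
  where
  allFinList : ∀ m → List (Fin m)
  allFinList zero    = []
  allFinList (suc m) = zero ∷ map suc (allFinList m)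

Injective? : ∀ {n} (σ : Fin n → Fin n) → Dec (∀ i j → σ i ≡ σ j → i ≡ j)
Injective? σ = all? (λ i → all? (λ j → (σ i ≟ σ j) →-dec (i ≟ j)))

perms : ∀ n → List (Fin n → Fin n)
perms n = filter Injective? (allFuns n n)

inversions : ∀ {n} → (Fin n → Fin n) → ℕ
inversions σ = sumFin (λ i → count (λ j → isInv i j))
  where
  isInv : _ → _ → Bool
  isInv i j with i <? j | σ j <? σ i
  ... | yes _ | yes _ = true
  ... | _         | _         = false

module MatrixOps {c ℓ} (R : CommutativeRing c ℓ) where
  open CommutativeRing R using (Carrier; _+_; _*_; -_; 0#; 1#)

  Matrix : ℕ → ℕ → Set c
  Matrix m n = Fin m → Fin n → Carrier

  prod : ∀ {n} → (Fin n → Carrier) → Carrier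
  prod {zero}  f = 1#
  prod {suc n} f = f zero * prod (λ i → f (suc i))

  sumList : List Carrier → Carrier
  sumList = foldr _+_ 0#

  signPow : ℕ → Carrier
  signPow zero    = 1#
  signPow (suc m) = - signPow m

  per : ∀ {n} → Matrix n n → Carrier
  per {n} B = sumList (map (λ σ → prod (λ i → B i (σ i))) (perms n))

  det : ∀ {n} → Matrix n n → Carrier
  det {n} B = sumList (map (λ σ → signPow (inversions σ) * prod (λ i → B i (σ i))) (perms n))

  biadjacency : ∀ {k l} → (Fin k → Fin l → Bool) → Matrix k l → Matrix k l
  biadjacency E w p q = if E p q then w p q else 0#

  StrictlyIncreasing : ∀ {n m} → (Fin n → Fin m) → Set
  StrictlyIncreasing f = ∀ i j → i < j → f i < f j

  submatrix : ∀ {k l n} → Matrix k l → (Fin n → Fin k) → (Fin n → Fin l) → Matrix n n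
  submatrix A r c i j = A (r i) (c j)

{-# OPTIONS --safe #-}
module Submission where

open import Defs
open import Algebra.Bundles using (CommutativeRing)
open import Data.Bool using (Bool; true; false)
open import Data.Nat using (ℕ; zero; suc)
open import Data.Nat.Properties using (0≢1+n)
open import Data.Fin using (Fin; zero; suc; _<_; _<?_)
open import Data.Product using (_×_; _,_; ∃; ∃₂)
open import Data.Sum using (_⊎_; inj₁; inj₂)
open import Data.List using (List; []; _∷_; map)
open import Relation.Nullary using (yes)
open import Relation.Binary.PropositionalEquality using (_≡_; _≢_)
import Relation.Binary.PropositionalEquality as ≡

-- A permutation with an inversion i < j, σ j < σ i pairs two entries of B
-- whose edges cross, so its term vanishes; every surviving term comes from
-- a permutation without inversions, whose sign is +1.

count≢0⇒∃true : ∀ {n} (b : Fin n → Bool) → count b ≢ 0 → ∃ λ i → b i ≡ true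
count≢0⇒∃true {zero} b h with () ← h ≡.refl
count≢0⇒∃true {suc n} b h with b zero in eq
... | true = zero , eq
... | false with i , bi ← count≢0⇒∃true (λ i → b (suc i)) h = suc i , bi

sumFin≢0⇒∃≢0 : ∀ {n} (f : Fin n → ℕ) → sumFin f ≢ 0 → ∃ λ i → f i ≢ 0
sumFin≢0⇒∃≢0 {zero} f h with () ← h ≡.refl
sumFin≢0⇒∃≢0 {suc n} f h with f zero in eq
... | suc m = zero , λ e → 0≢1+n (≡.trans (≡.sym e) eq)
... | zero with i , fi ← sumFin≢0⇒∃≢0 (λ i → f (suc i)) h = suc i , fi

inversions≢0⇒∃inversion : ∀ {n} (σ : Fin n → Fin n) → inversions σ ≢ 0 →
                          ∃₂ λ i j → i < j × σ j < σ i
inversions≢0⇒∃inversion σ h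
  with i , hi ← sumFin≢0⇒∃≢0 _ h
  with j , hij ← count≢0⇒∃true _ hi
  with i <? j | σ j <? σ i
... | yes i<j | yes σj<σi = i , j , i<j , σj<σi

module _ {c ℓ} (R : CommutativeRing c ℓ) where
  open CommutativeRing R
  open MatrixOps R

  sumList-map-cong : ∀ {A : Set} {f g : A → Carrier} (xs : List A) →
                     (∀ x → f x ≈ g x) → sumList (map f xs) ≈ sumList (map g xs)
  sumList-map-cong []       f≈g = refl
  sumList-map-cong (x ∷ xs) f≈g = +-cong (f≈g x) (sumList-map-cong xs f≈g)

  prod-zero : ∀ {n} (f : Fin n → Carrier) (i : Fin n) → f i ≈ 0# → prod f ≈ 0#
  prod-zero f zero    fi≈0 = trans (*-congʳ fi≈0) (zeroˡ _)
  prod-zero f (suc i) fi≈0 = trans (*-congˡ (prod-zero (λ j → f (suc j)) i fi≈0)) (zeroʳ _)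

  NoInvertedPair : ∀ {n} → Matrix n n → Set ℓ
  NoInvertedPair B = ∀ i j a b → i < j → b < a → B i a ≈ 0# ⊎ B j b ≈ 0#

  module _ {n} {B : Matrix n n} (noInv : NoInvertedPair B) where

    diagonalProduct : (Fin n → Fin n) → Carrier
    diagonalProduct σ = prod (λ i → B i (σ i))

    diagonalProduct≈0 : ∀ σ i j → i < j → σ j < σ i → diagonalProduct σ ≈ 0#
    diagonalProduct≈0 σ i j i<j σj<σi with noInv i j (σ i) (σ j) i<j σj<σi
    ... | inj₁ Biσi≈0 = prod-zero _ i Biσi≈0
    ... | inj₂ Bjσj≈0 = prod-zero _ j Bjσj≈0

    term≈signedTerm : ∀ σ → diagonalProduct σ ≈ signPow (inversions σ) * diagonalProduct σ
    term≈signedTerm σ with inversions σ in eq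
    ... | zero  = sym (*-identityˡ _)
    ... | suc m with i , j , i<j , σj<σi ← inversions≢0⇒∃inversion σ (λ e → 0≢1+n (≡.trans (≡.sym e) eq)) =
      trans vanishes (sym (trans (*-congˡ vanishes) (zeroʳ _)))
      where vanishes = diagonalProduct≈0 σ i j i<j σj<σi

    per≈det : per B ≈ det B
    per≈det = sumList-map-cong (perms n) term≈signedTerm

  noInvertedPair-submatrix : ∀ {k l n} {E : Fin k → Fin l → Bool} (w : Matrix k l)
                             {r : Fin n → Fin k} {s : Fin n → Fin l} →
                             NonCrossing E → StrictlyIncreasing r → StrictlyIncreasing s →
                             NoInvertedPair (submatrix (biadjacency E w) r s)
  noInvertedPair-submatrix {E = E} w {r} {s} nc r↑ s↑ i j a b i<j b<a
    with E (r i) (s a) in e₁ | E (r j) (s b) in e₂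
  ... | false | _     = inj₁ refl
  ... | true  | false = inj₂ refl
  ... | true  | true with () ← nc (r i) (r j) (s a) (s b) (r↑ i j i<j) (s↑ b a b<a) (e₁ , e₂)

lemma2p3 : ∀ {c ℓ} (R : CommutativeRing c ℓ) (k l : ℕ)
           (E : Fin k → Fin l → Bool) (w : MatrixOps.Matrix R k l) →
           IsStrand E →
           ∀ (n : ℕ) (r : Fin n → Fin k) (s : Fin n → Fin l) →
           MatrixOps.StrictlyIncreasing R r → MatrixOps.StrictlyIncreasing R s →
           let B = MatrixOps.submatrix R (MatrixOps.biadjacency R E w) r s in
           CommutativeRing._≈_ R (MatrixOps.per R B) (MatrixOps.det R B)
lemma2p3 R k l E w (_ , nonCrossing) n r s r↑ s↑ =
  per≈det R (noInvertedPair-submatrix R w nonCrossing r↑ s↑)
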